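{- The set of rational solutions $(\xi,\zeta,\eta)\in\mathbb{Q}^3$ of $$\eta^2=\xi\zeta(\xi^2-1)(\zeta^2-1)$$ with $\eta\neq 0$ and $\xi\neq\zeta$ is exactly the set of triples $$(\xi,\zeta,\eta)=\Big(\frac{X}{N},\frac{Z}{N},\frac{YW}{N^3}\Big),$$ where $N$ ranges over nonzero rational numbers and $(X,Y)$, $(Z,W)$ range over rational points of $C_N: y^2=x^3-N^2x$ with $Y\neq0$, $W\neq 0$ and $X\neq Z$. -}

module Defs where

open import Data.Rational using (ℚ; 0ℚ; 1ℚ; _*_; _-_; _÷_; ≢-nonZero)
open import Relation.Binary.PropositionalEquality using (_≡_; _≢_)
open import Data.Product using (_×_)

OnSurface : ℚ → ℚ → ℚ → Set
OnSurface ξ ζ η = η * η ≡ ξ * ζ * (ξ * ξ - 1ℚ) * (ζ * ζ - 1ℚ)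

OnCN : ℚ → ℚ → ℚ → Set
OnCN N x y = y * y ≡ x * x * x - N * N * x

divQ : (p q : ℚ) → q ≢ 0ℚ → ℚ
divQ p q q≢0 = _÷_ p q {{≢-nonZero q≢0}}

divCube : (p N : ℚ) → N ≢ 0ℚ → ℚ
divCube p N N≢0 = divQ (divQ (divQ p N N≢0) N N≢0) N N≢0

{-# OPTIONS --safe #-}
-- Write c(t) = t(t² − 1), so that the surface reads η² = c(ξ) c(ζ) and C_N is the
-- quadratic twist N v² = c(t) of C_1, via (x, y) = (t N, N v).  Given a surface point
-- with η ≠ 0, put N = c(ξ) ≠ 0: then v = N and v = η solve N v² = c(ξ) and N v² = c(ζ),
-- giving the two points (ξ N, N²) and (ζ N, N η) of C_N.  Conversely two points
-- (X, Y), (Z, W) of C_N give (Y W)² = N⁶ c(X/N) c(Z/N), i.e. a surface point after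
-- dividing by N⁶.
module Submission where

open import Defs
open import Data.Rational using (ℚ; 0ℚ; 1ℚ; _*_; _-_; 1/_; ≢-nonZero; _≟_)
open import Data.Rational.Properties
  using (+-*-commutativeRing; *-assoc; *-comm; *-identityʳ; *-zeroˡ; *-inverseˡ; *-inverseʳ)
open import Relation.Binary.PropositionalEquality
open import Function using (id)
open import Relation.Nullary using (yes; no)
open import Data.Maybe using (just; nothing)
open import Data.Product using (_×_; Σ; ∃; _,_)
open import Tactic.RingSolver using (solve-∀)
open import Tactic.RingSolver.Core.AlmostCommutativeRing using (AlmostCommutativeRing; fromCommutativeRing)

open ≡-Reasoning

ℚ-ring : AlmostCommutativeRing _ _
ℚ-ring = fromCommutativeRing +-*-commutativeRing isZero
  where
  isZero : ∀ x → _
  isZero x with 0ℚ ≟ x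
  ... | yes 0≡x = just 0≡x
  ... | no  _   = nothing

*-cancelʳ-≡ : ∀ {p q} r → r ≢ 0ℚ → p * r ≡ q * r → p ≡ q
*-cancelʳ-≡ {p} {q} r r≢0 pr≡qr = begin
  p                ≡⟨ sym (*-identityʳ p) ⟩
  p * 1ℚ           ≡⟨ cong (p *_) (sym (*-inverseʳ r)) ⟩
  p * (r * 1/ r)   ≡⟨ sym (*-assoc p r _) ⟩
  p * r * 1/ r     ≡⟨ cong (_* 1/ r) pr≡qr ⟩
  q * r * 1/ r     ≡⟨ *-assoc q r _ ⟩
  q * (r * 1/ r)   ≡⟨ cong (q *_) (*-inverseʳ r) ⟩
  q * 1ℚ           ≡⟨ *-identityʳ q ⟩
  q                ∎
  where instance _ = ≢-nonZero r≢0

p≢0∧q≢0⇒p*q≢0 : ∀ {p q} → p ≢ 0ℚ → q ≢ 0ℚ → p * q ≢ 0ℚ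
p≢0∧q≢0⇒p*q≢0 {p} {q} p≢0 q≢0 pq≡0 =
  q≢0 (*-cancelʳ-≡ p p≢0 (trans (*-comm q p) (trans pq≡0 (sym (*-zeroˡ p)))))

divQ-*-cancel : ∀ p q (q≢0 : q ≢ 0ℚ) → divQ p q q≢0 * q ≡ p
divQ-*-cancel p q q≢0 = begin
  p * 1/ q * q     ≡⟨ *-assoc p _ q ⟩
  p * (1/ q * q)   ≡⟨ cong (p *_) (*-inverseˡ q) ⟩
  p * 1ℚ           ≡⟨ *-identityʳ p ⟩
  p                ∎
  where instance _ = ≢-nonZero q≢0

*-divQ-cancel : ∀ p q (q≢0 : q ≢ 0ℚ) → divQ (p * q) q q≢0 ≡ p
*-divQ-cancel p q q≢0 = *-cancelʳ-≡ q q≢0 (divQ-*-cancel (p * q) q q≢0)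

divCube-*-cancel : ∀ p N (N≢0 : N ≢ 0ℚ) → divCube p N N≢0 * N * N * N ≡ p
divCube-*-cancel p N N≢0 = begin
  divQ (divQ (divQ p N N≢0) N N≢0) N N≢0 * N * N * N
    ≡⟨ cong (λ x → x * N * N) (divQ-*-cancel (divQ (divQ p N N≢0) N N≢0) N N≢0) ⟩
  divQ (divQ p N N≢0) N N≢0 * N * N
    ≡⟨ cong (_* N) (divQ-*-cancel (divQ p N N≢0) N N≢0) ⟩
  divQ p N N≢0 * N
    ≡⟨ divQ-*-cancel p N N≢0 ⟩
  p ∎

*-divCube-cancel : ∀ p N (N≢0 : N ≢ 0ℚ) → divCube (p * N * N * N) N N≢0 ≡ p
*-divCube-cancel p N N≢0 = begin
  divQ (divQ (divQ (p * N * N * N) N N≢0) N N≢0) N N≢0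
    ≡⟨ cong (λ x → divQ (divQ x N N≢0) N N≢0) (*-divQ-cancel (p * N * N) N N≢0) ⟩
  divQ (divQ (p * N * N) N N≢0) N N≢0
    ≡⟨ cong (λ x → divQ x N N≢0) (*-divQ-cancel (p * N) N N≢0) ⟩
  divQ (p * N) N N≢0
    ≡⟨ *-divQ-cancel p N N≢0 ⟩
  p ∎

onSurface-factored : ∀ ξ ζ η → OnSurface ξ ζ η ≡ (η * η ≡ (ξ * (ξ * ξ - 1ℚ)) * (ζ * (ζ * ζ - 1ℚ)))
onSurface-factored ξ ζ η = cong (η * η ≡_) (factor ξ ζ)
  where
  factor : ∀ ξ ζ → ξ * ζ * (ξ * ξ - 1ℚ) * (ζ * ζ - 1ℚ) ≡ (ξ * (ξ * ξ - 1ℚ)) * (ζ * (ζ * ζ - 1ℚ))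
  factor = solve-∀ ℚ-ring

onCN-scaled : ∀ N t y → OnCN N (t * N) y ≡ (y * y ≡ N * N * N * (t * (t * t - 1ℚ)))
onCN-scaled N t y = cong (y * y ≡_) (scale N t)
  where
  scale : ∀ N t → t * N * (t * N) * (t * N) - N * N * (t * N) ≡ N * N * N * (t * (t * t - 1ℚ))
  scale = solve-∀ ℚ-ring

twist⇒onCN : ∀ N t v → v * v ≡ N * (t * (t * t - 1ℚ)) → OnCN N (t * N) (N * v)
twist⇒onCN N t v twist = subst id (sym (onCN-scaled N t (N * v))) (begin
  N * v * (N * v)                  ≡⟨ square-* N v ⟩
  N * N * (v * v)                  ≡⟨ cong (N * N *_) twist ⟩
  N * N * (N * (t * (t * t - 1ℚ))) ≡⟨ *-assoc (N * N) N _ ⟨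
  N * N * N * (t * (t * t - 1ℚ))   ∎)
  where
  square-* : ∀ N v → N * v * (N * v) ≡ N * N * (v * v)
  square-* = solve-∀ ℚ-ring

onCN⇒twist : ∀ N (N≢0 : N ≢ 0ℚ) x y → OnCN N x y →
  y * y ≡ N * N * N * (divQ x N N≢0 * (divQ x N N≢0 * divQ x N N≢0 - 1ℚ))
onCN⇒twist N N≢0 x y onC = subst id (onCN-scaled N (divQ x N N≢0) y)
  (subst (λ x → OnCN N x y) (sym (divQ-*-cancel x N N≢0)) onC)

square-of-product-of-twists : ∀ {N a b} η y w → N ≢ 0ℚ →
  η * N * N * N ≡ y * w → y * y ≡ N * N * N * a → w * w ≡ N * N * N * b → η * η ≡ a * b
square-of-product-of-twists {N} {a} {b} η y w N≢0 ηN³≡yw yy≡N³a ww≡N³b =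
  *-cancelʳ-≡ (N * N * N * (N * N * N)) N⁶≢0 (begin
    η * η * (N * N * N * (N * N * N))    ≡⟨ regroup₁ η N ⟩
    η * N * N * N * (η * N * N * N)      ≡⟨ cong₂ _*_ ηN³≡yw ηN³≡yw ⟩
    y * w * (y * w)                      ≡⟨ regroup₂ y w ⟩
    y * y * (w * w)                      ≡⟨ cong₂ _*_ yy≡N³a ww≡N³b ⟩
    N * N * N * a * (N * N * N * b)      ≡⟨ regroup₃ N a b ⟩
    a * b * (N * N * N * (N * N * N))    ∎)
  where
  N³≢0 : N * N * N ≢ 0ℚ
  N³≢0 = p≢0∧q≢0⇒p*q≢0 (p≢0∧q≢0⇒p*q≢0 N≢0 N≢0) N≢0
  N⁶≢0 : N * N * N * (N * N * N) ≢ 0ℚ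
  N⁶≢0 = p≢0∧q≢0⇒p*q≢0 N³≢0 N³≢0
  regroup₁ : ∀ η N → η * η * (N * N * N * (N * N * N)) ≡ η * N * N * N * (η * N * N * N)
  regroup₁ = solve-∀ ℚ-ring
  regroup₂ : ∀ y w → y * w * (y * w) ≡ y * y * (w * w)
  regroup₂ = solve-∀ ℚ-ring
  regroup₃ : ∀ N a b → N * N * N * a * (N * N * N * b) ≡ a * b * (N * N * N * (N * N * N))
  regroup₃ = solve-∀ ℚ-ring

surface⇒curves : (ξ ζ η : ℚ) → OnSurface ξ ζ η → η ≢ 0ℚ → ξ ≢ ζ →
  Σ ℚ λ N → Σ (N ≢ 0ℚ) λ N≢0 → ∃ λ X → ∃ λ Y → ∃ λ Z → ∃ λ W →
    OnCN N X Y × OnCN N Z W × Y ≢ 0ℚ × W ≢ 0ℚ × X ≢ Z ×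
    ξ ≡ divQ X N N≢0 × ζ ≡ divQ Z N N≢0 × η ≡ divCube (Y * W) N N≢0
surface⇒curves ξ ζ η surface η≢0 ξ≢ζ =
  N , N≢0 , ξ * N , N * N , ζ * N , N * η ,
  twist⇒onCN N ξ N refl , twist⇒onCN N ζ η ηη≡Nb ,
  p≢0∧q≢0⇒p*q≢0 N≢0 N≢0 , p≢0∧q≢0⇒p*q≢0 N≢0 η≢0 ,
  (λ ξN≡ζN → ξ≢ζ (*-cancelʳ-≡ N N≢0 ξN≡ζN)) ,
  sym (*-divQ-cancel ξ N N≢0) , sym (*-divQ-cancel ζ N N≢0) , sym η≡YW/N³
  where
  N b : ℚ
  N = ξ * (ξ * ξ - 1ℚ)
  b = ζ * (ζ * ζ - 1ℚ)
  ηη≡Nb : η * η ≡ N * b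
  ηη≡Nb = subst id (onSurface-factored ξ ζ η) surface
  N≢0 : N ≢ 0ℚ
  N≢0 N≡0 = p≢0∧q≢0⇒p*q≢0 η≢0 η≢0 (trans ηη≡Nb (trans (cong (_* b) N≡0) (*-zeroˡ b)))
  regroup : ∀ N η → N * N * (N * η) ≡ η * N * N * N
  regroup = solve-∀ ℚ-ring
  η≡YW/N³ : divCube (N * N * (N * η)) N N≢0 ≡ η
  η≡YW/N³ = trans (cong (λ p → divCube p N N≢0) (regroup N η)) (*-divCube-cancel η N N≢0)

curves⇒surface : (N : ℚ) (N≢0 : N ≢ 0ℚ) (X Y Z W : ℚ) →
  OnCN N X Y → OnCN N Z W → Y ≢ 0ℚ → W ≢ 0ℚ → X ≢ Z →
  OnSurface (divQ X N N≢0) (divQ Z N N≢0) (divCube (Y * W) N N≢0)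
    × divCube (Y * W) N N≢0 ≢ 0ℚ × divQ X N N≢0 ≢ divQ Z N N≢0
curves⇒surface N N≢0 X Y Z W onX onZ Y≢0 W≢0 X≢Z = surface , η≢0 , ξ≢ζ
  where
  ξ ζ η : ℚ
  ξ = divQ X N N≢0
  ζ = divQ Z N N≢0
  η = divCube (Y * W) N N≢0
  surface : OnSurface ξ ζ η
  surface = subst id (sym (onSurface-factored ξ ζ η))
    (square-of-product-of-twists η Y W N≢0 (divCube-*-cancel (Y * W) N N≢0)
      (onCN⇒twist N N≢0 X Y onX) (onCN⇒twist N N≢0 Z W onZ))
  η≢0 : η ≢ 0ℚ
  η≢0 η≡0 = p≢0∧q≢0⇒p*q≢0 Y≢0 W≢0 (begin
    Y * W          ≡⟨ divCube-*-cancel (Y * W) N N≢0 ⟨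
    η * N * N * N  ≡⟨ cong (λ x → x * N * N * N) η≡0 ⟩
    0ℚ * N * N * N ≡⟨ zero-cube N ⟩
    0ℚ             ∎)
    where
    zero-cube : ∀ N → 0ℚ * N * N * N ≡ 0ℚ
    zero-cube = solve-∀ ℚ-ring
  ξ≢ζ : ξ ≢ ζ
  ξ≢ζ ξ≡ζ = X≢Z (begin
    X      ≡⟨ divQ-*-cancel X N N≢0 ⟨
    ξ * N  ≡⟨ cong (_* N) ξ≡ζ ⟩
    ζ * N  ≡⟨ divQ-*-cancel Z N N≢0 ⟩
    Z      ∎)

mainTheorem10 :
    ((ξ ζ η : ℚ) → OnSurface ξ ζ η → η ≢ 0ℚ → ξ ≢ ζ →
      Σ ℚ λ N → Σ (N ≢ 0ℚ) λ N≢0 → ∃ λ X → ∃ λ Y → ∃ λ Z → ∃ λ W →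
        OnCN N X Y × OnCN N Z W × Y ≢ 0ℚ × W ≢ 0ℚ × X ≢ Z ×
        ξ ≡ divQ X N N≢0 × ζ ≡ divQ Z N N≢0 × η ≡ divCube (Y * W) N N≢0)
    ×
    ((N : ℚ) (N≢0 : N ≢ 0ℚ) (X Y Z W : ℚ) →
      OnCN N X Y → OnCN N Z W → Y ≢ 0ℚ → W ≢ 0ℚ → X ≢ Z →
      OnSurface (divQ X N N≢0) (divQ Z N N≢0) (divCube (Y * W) N N≢0)
      × divCube (Y * W) N N≢0 ≢ 0ℚ × divQ X N N≢0 ≢ divQ Z N N≢0)
mainTheorem10 = surface⇒curves , curves⇒surface
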